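{- Let $\eta\in\{1,-1\}$ and let $m,l$ be integers with $l\ge2$ and $m\ge0$. Then $$\sum_{k=0}^m\sum_{n\ge0}\eta^n\frac{\zeta_n(1_{m-k})\zeta^\star_{n+1}(1_k)}{(n+1)^l}=\eta\sum_{d=1}^{m+1}\sum_{\substack{\mathbf{s}=(s_1,\dots,s_d)\in\mathbb{N}^d\\|\mathbf{s}|=m+2,\ s_1\ge2}}2^{d-1}\zeta(s_1+l-2,s_2,\dots,s_d;\eta,1_{d-1}),$$ $$\sum_{k=0}^m\sum_{n\ge0}\eta^n\frac{t_n(1_{m-k})t^\star_{n+1}(1_k)}{(2n+1)^l}=\eta\sum_{d=1}^{m+1}\sum_{\substack{\mathbf{s}=(s_1,\dots,s_d)\in\mathbb{N}^d\\|\mathbf{s}|=m+2,\ s_1\ge2}}2^{d-1}t(s_1+l-2,s_2,\dots,s_d;\eta,1_{d-1}).$$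
   Context: For a composition $\mathbf{k}=(k_1,\dots,k_r)$ and $n\in\mathbb{N}_0$: $\zeta_n(\mathbf{k})=\sum_{n\ge n_1>\cdots>n_r>0}\prod_j n_j^{ -k_j}$, $\zeta^\star_n(\mathbf{k})$ the same with $\ge$ in place of $>$; $t_n(\mathbf{k})=\sum_{n\ge n_1>\cdots>n_r>0}\prod_j(2n_j-1)^{ -k_j}$, $t^\star_n$ the same with $\ge$; all equal $1$ on the empty composition. $1_d$ is the string of $d$ ones, $|\mathbf{s}|=s_1+\cdots+s_d$. For $\mathbf{s}\in\mathbb{N}^d$ with $s_1\ge2$: $\zeta(\mathbf{s};\eta,1_{d-1})=\sum_{n_1>\cdots>n_d>0}\frac{\eta^{n_1}}{n_1^{s_1}\cdots n_d^{s_d}}$ and $t(\mathbf{s};\eta,1_{d-1})=\sum_{n_1>\cdots>n_d>0}\frac{\eta^{n_1}}{(2n_1-1)^{s_1}\cdots(2n_d-1)^{s_d}}$. -}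

module Defs where

open import Data.Nat as ℕ using (ℕ; zero; suc)
open import Data.Integer using (+_)
open import Data.Rational using (ℚ; 0ℚ; 1ℚ; _+_; _*_; _/_)
open import Data.List using (List; []; _∷_; length; map; concatMap)
open import Data.Bool using (Bool; true; false; if_then_else_)

_^q_ : ℚ → ℕ → ℚ
p ^q zero = 1ℚ
p ^q suc k = p * (p ^q k)

sumFrom1 : ℕ → (ℕ → ℚ) → ℚ
sumFrom1 zero f = 0ℚ
sumFrom1 (suc n) f = sumFrom1 n f + f (suc n)

sumFrom0 : ℕ → (ℕ → ℚ) → ℚ
sumFrom0 n f = f 0 + sumFrom1 n f

-- 1 / j  for j ≥ 1 (value 0 at j = 0, never used)
recip : ℕ → ℚ
recip zero = 0ℚ
recip (suc i) = + 1 / suc i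

-- 1 / (2j - 1) for j ≥ 1 (value 0 at j = 0, never used)
recipOdd : ℕ → ℚ
recipOdd zero = 0ℚ
recipOdd (suc i) = + 1 / suc (2 ℕ.* i)

-- ζ_n(k) = Σ_{n ≥ n1 > ... > nr > 0} Π n_j^{-k_j}
ζₙ : ℕ → List ℕ → ℚ
ζₙ n [] = 1ℚ
ζₙ n (k ∷ ks) = sumFrom1 n (λ n₁ → (recip n₁ ^q k) * ζₙ (ℕ.pred n₁) ks)

-- ζ⋆_n(k) = Σ_{n ≥ n1 ≥ ... ≥ nr > 0} Π n_j^{-k_j}
ζ⋆ₙ : ℕ → List ℕ → ℚ
ζ⋆ₙ n [] = 1ℚ
ζ⋆ₙ n (k ∷ ks) = sumFrom1 n (λ n₁ → (recip n₁ ^q k) * ζ⋆ₙ n₁ ks)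

-- t_n(k) = Σ_{n ≥ n1 > ... > nr > 0} Π (2n_j - 1)^{-k_j}
tₙ : ℕ → List ℕ → ℚ
tₙ n [] = 1ℚ
tₙ n (k ∷ ks) = sumFrom1 n (λ n₁ → (recipOdd n₁ ^q k) * tₙ (ℕ.pred n₁) ks)

-- t⋆_n(k) = Σ_{n ≥ n1 ≥ ... ≥ nr > 0} Π (2n_j - 1)^{-k_j}
t⋆ₙ : ℕ → List ℕ → ℚ
t⋆ₙ n [] = 1ℚ
t⋆ₙ n (k ∷ ks) = sumFrom1 n (λ n₁ → (recipOdd n₁ ^q k) * t⋆ₙ n₁ ks)

ones : ℕ → List ℕ
ones zero = []
ones (suc d) = 1 ∷ ones d

-- Partial sum (n₁ ≤ N) of ζ(s₁,…,s_d; η, 1_{d-1}) = Σ_{n1>…>nd>0} η^{n1} / (n1^{s1} ⋯ nd^{sd})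
ζηPartial : ℚ → ℕ → List ℕ → ℚ
ζηPartial η N [] = 0ℚ
ζηPartial η N (s₁ ∷ ss) = sumFrom1 N (λ n₁ → (η ^q n₁) * (recip n₁ ^q s₁) * ζₙ (ℕ.pred n₁) ss)

-- Partial sum (n₁ ≤ N) of t(s₁,…,s_d; η, 1_{d-1})
tηPartial : ℚ → ℕ → List ℕ → ℚ
tηPartial η N [] = 0ℚ
tηPartial η N (s₁ ∷ ss) = sumFrom1 N (λ n₁ → (η ^q n₁) * (recipOdd n₁ ^q s₁) * tₙ (ℕ.pred n₁) ss)

-- All lists of length d with entries in {1,…,B}
vecs : ℕ → ℕ → List (List ℕ)
vecs zero B = [] ∷ []
vecs (suc d) B = concatMap (λ rest → go B rest) (vecs d B)
  where
  go : ℕ → List ℕ → List (List ℕ)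
  go zero rest = []
  go (suc j) rest = (suc j ∷ rest) ∷ go j rest

sumList : List ℚ → ℚ
sumList [] = 0ℚ
sumList (x ∷ xs) = x + sumList xs

total : List ℕ → ℕ
total [] = 0
total (x ∷ xs) = x ℕ.+ total xs

admissible : ℕ → List ℕ → Bool
admissible w [] = false
admissible w (s₁ ∷ ss) with total (s₁ ∷ ss) ℕ.≡ᵇ w | 2 ℕ.≤ᵇ s₁
... | true | true = true
... | _ | _ = false

-- Σ_{s ∈ ℕ^d, |s| = w, s₁ ≥ 2} F s   (entries of such s are automatically ≤ w)
ΣComp : ℕ → ℕ → (List ℕ → ℚ) → ℚ
ΣComp d w F = sumList (map (λ s → if admissible w s then F s else 0ℚ) (vecs d w))

shiftHead : ℕ → List ℕ → List ℕ
shiftHead l [] = []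
shiftHead l (s₁ ∷ ss) = (s₁ ℕ.+ l ℕ.∸ 2) ∷ ss

two : ℚ
two = + 2 / 1

lhsζ : ℚ → ℕ → ℕ → ℕ → ℚ
lhsζ η m l N = sumFrom0 m (λ k → sumFrom0 N (λ n →
  (η ^q n) * ζₙ n (ones (m ℕ.∸ k)) * ζ⋆ₙ (suc n) (ones k) * (recip (suc n) ^q l)))

rhsζ : ℚ → ℕ → ℕ → ℕ → ℚ
rhsζ η m l N = η * sumFrom1 (suc m) (λ d → ΣComp d (m ℕ.+ 2) (λ s →
  (two ^q (ℕ.pred d)) * ζηPartial η N (shiftHead l s)))

lhst : ℚ → ℕ → ℕ → ℕ → ℚ
lhst η m l N = sumFrom0 m (λ k → sumFrom0 N (λ n →
  (η ^q n) * tₙ n (ones (m ℕ.∸ k)) * t⋆ₙ (suc n) (ones k) * (recipOdd (suc n) ^q l)))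

rhst : ℚ → ℕ → ℕ → ℕ → ℚ
rhst η m l N = η * sumFrom1 (suc m) (λ d → ΣComp d (m ℕ.+ 2) (λ s →
  (two ^q (ℕ.pred d)) * tηPartial η N (shiftHead l s)))

open import Data.Rational using (_-_; ∣_∣; _≤_; _<_)
open import Data.Product using (∃-syntax)

SameLimit : (ℕ → ℚ) → (ℕ → ℚ) → Set
SameLimit a b = ∀ (ε : ℚ) → 0ℚ < ε → ∃[ M ] (∀ N → M ℕ.≤ N → ∣ a N - b N ∣ ≤ ε)

-- With weights x_a = 1/a (resp. 1/(2a − 1)), ζₙ(1_r) and ζ⋆ₙ(1_k) are the elementary and complete
-- symmetric polynomials e_r and h_k of x₁, …, xₙ. The generating function of Σ_k e_{t−k} h_k is
-- ∏_{a≤n} (1 + x_a z)/(1 − x_a z) = ∏_{a≤n} (1 + 2 Σ_{j≥1} x_a^j z^j), so this convolution is a sum over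
-- compositions of t weighted by 2^(number of parts); one more factor 1/(1 − x_{n+1} z) turns h_k into
-- h_k(x₁, …, x_{n+1}). Comparing coefficients of z^m shows that, as η² = 1, the n-th summand of the left
-- side equals the part of the right side with n₁ = n + 1. So the partial sums differ by one term
-- η^N x_{N+1}^l Σ_k e_{m−k} h_k, at most (m + 1) H_{N+1}^m / (N + 1)², which is O(1/N) since H_{2^j} ≤ j + 1.

module Submission where

open import Defs
open import Algebra.Bundles using (CommutativeMonoid)
open import Data.Bool using (Bool; true; false; if_then_else_)
import Data.Integer as ℤ
import Data.Integer.Properties as ℤₚ
open import Data.List using (List; []; _∷_; map; concatMap; _++_)
open import Data.Nat as ℕ using (ℕ; zero; suc; z≤n; s≤s; _∸_; _^_)
import Data.Nat.Coprimality as Coprimality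
open import Data.Nat.DivMod using (_%_; m≡m%n+[m/n]*n; m%n<n)
import Data.Nat.Properties as ℕₚ
open import Data.Product using (Σ; ∃-syntax; _×_; _,_; proj₁; proj₂)
open import Data.Rational
  using (ℚ; mkℚ; 0ℚ; 1ℚ; _+_; _*_; _-_; -_; _/_; _≤_; ∣_∣; *≤*; *<*; nonNegative)
open import Data.Rational.Properties
open import Data.Rational.Solver using (module +-*-Solver)
open import Data.Sum using (_⊎_; inj₁; inj₂)
open import Function using (_∘_)
open import Relation.Binary.PropositionalEquality
  using (_≡_; refl; sym; trans; cong; cong₂; subst; subst₂; module ≡-Reasoning)
open import Relation.Nullary using (yes; no)
open +-*-Solver using (solve; _:+_; _:*_; _:-_; _:=_; con)

-- Finite sums

∑ : ℕ → (ℕ → ℚ) → ℚ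
∑ zero    f = 0ℚ
∑ (suc n) f = ∑ n f + f n

∑-syntax : ℕ → (ℕ → ℚ) → ℚ
∑-syntax = ∑

infix 5 ∑-syntax
syntax ∑-syntax n (λ i → e) = ∑[ i < n ] e

∑-cong : ∀ n {f g : ℕ → ℚ} → (∀ i → f i ≡ g i) → ∑ n f ≡ ∑ n g
∑-cong zero    f≡g = refl
∑-cong (suc n) f≡g = cong₂ _+_ (∑-cong n f≡g) (f≡g n)

∑-cong-< : ∀ n {f g : ℕ → ℚ} → (∀ i → i ℕ.< n → f i ≡ g i) → ∑ n f ≡ ∑ n g
∑-cong-< zero    f≡g = refl
∑-cong-< (suc n) f≡g =
  cong₂ _+_ (∑-cong-< n (λ i i<n → f≡g i (ℕₚ.m<n⇒m<1+n i<n))) (f≡g n ℕₚ.≤-refl)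

∑-zero : ∀ n → ∑[ i < n ] 0ℚ ≡ 0ℚ
∑-zero zero    = refl
∑-zero (suc n) = trans (+-identityʳ (∑ n _)) (∑-zero n)

∑-distrib-+ : ∀ n (f g : ℕ → ℚ) → ∑[ i < n ] (f i + g i) ≡ ∑ n f + ∑ n g
∑-distrib-+ zero    f g = sym (+-identityˡ 0ℚ)
∑-distrib-+ (suc n) f g = trans (cong (_+ (f n + g n)) (∑-distrib-+ n f g))
                                (interchange (∑ n f) _ (f n) _)
  where open import Algebra.Properties.CommutativeSemigroup
          (CommutativeMonoid.commutativeSemigroup +-0-commutativeMonoid) using (interchange)

*-distribˡ-∑ : ∀ n c (f : ℕ → ℚ) → c * ∑ n f ≡ ∑[ i < n ] (c * f i)
*-distribˡ-∑ zero    c f = *-zeroʳ c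
*-distribˡ-∑ (suc n) c f =
  trans (*-distribˡ-+ c (∑ n f) (f n)) (cong (_+ c * f n) (*-distribˡ-∑ n c f))

*-distribʳ-∑ : ∀ n c (f : ℕ → ℚ) → ∑ n f * c ≡ ∑[ i < n ] f i * c
*-distribʳ-∑ n c f = trans (*-comm (∑ n f) c) (trans (*-distribˡ-∑ n c f) (∑-cong n (λ i → *-comm c (f i))))

∑-suc : ∀ n (f : ℕ → ℚ) → ∑ (suc n) f ≡ f 0 + (∑[ i < n ] f (suc i))
∑-suc zero    f = trans (+-identityˡ (f 0)) (sym (+-identityʳ (f 0)))
∑-suc (suc n) f = trans (cong (_+ f (suc n)) (∑-suc n f)) (+-assoc (f 0) _ _)

∑-comm : ∀ n m (f : ℕ → ℕ → ℚ) → ∑[ i < n ] ∑[ j < m ] f i j ≡ ∑[ j < m ] ∑[ i < n ] f i j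
∑-comm zero    m f = sym (∑-zero m)
∑-comm (suc n) m f = trans (cong (_+ ∑ m (f n)) (∑-comm n m f))
                           (sym (∑-distrib-+ m (λ j → ∑[ i < n ] f i j) (f n)))

∑-split : ∀ a b (f : ℕ → ℚ) → ∑ (a ℕ.+ b) f ≡ ∑ a f + (∑[ i < b ] f (a ℕ.+ i))
∑-split a zero    f = trans (cong (λ k → ∑ k f) (ℕₚ.+-identityʳ a)) (sym (+-identityʳ (∑ a f)))
∑-split a (suc b) f = begin
  ∑ (a ℕ.+ suc b) f                             ≡⟨ cong (λ k → ∑ k f) (ℕₚ.+-suc a b) ⟩
  ∑ (a ℕ.+ b) f + f (a ℕ.+ b)                   ≡⟨ cong (_+ f (a ℕ.+ b)) (∑-split a b f) ⟩
  (∑ a f + (∑[ i < b ] f (a ℕ.+ i))) + f (a ℕ.+ b) ≡⟨ +-assoc (∑ a f) _ _ ⟩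
  ∑ a f + (∑[ i < suc b ] f (a ℕ.+ i))          ∎
  where open ≡-Reasoning

∑-truncate : ∀ {t} n (f : ℕ → ℚ) → t ℕ.≤ n → (∀ i → t ℕ.≤ i → f i ≡ 0ℚ) → ∑ n f ≡ ∑ t f
∑-truncate {t} n f t≤n vanish = begin
  ∑ n f                                 ≡⟨ cong (λ k → ∑ k f) (sym (ℕₚ.m+[n∸m]≡n t≤n)) ⟩
  ∑ (t ℕ.+ (n ∸ t)) f                   ≡⟨ ∑-split t (n ∸ t) f ⟩
  ∑ t f + (∑[ i < n ∸ t ] f (t ℕ.+ i)) ≡⟨ cong (∑ t f +_) (∑-cong (n ∸ t) (λ i → vanish _ (ℕₚ.m≤m+n t i))) ⟩
  ∑ t f + (∑[ i < n ∸ t ] 0ℚ)          ≡⟨ cong (∑ t f +_) (∑-zero (n ∸ t)) ⟩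
  ∑ t f + 0ℚ                            ≡⟨ +-identityʳ (∑ t f) ⟩
  ∑ t f                                 ∎
  where open ≡-Reasoning

sumFrom1≡∑ : ∀ n f → sumFrom1 n f ≡ ∑[ i < n ] f (suc i)
sumFrom1≡∑ zero    f = refl
sumFrom1≡∑ (suc n) f = cong (_+ f (suc n)) (sumFrom1≡∑ n f)

sumFrom0≡∑ : ∀ n f → sumFrom0 n f ≡ ∑ (suc n) f
sumFrom0≡∑ n f = trans (cong (f 0 +_) (sumFrom1≡∑ n f)) (sym (∑-suc n f))

sumFrom1-cong : ∀ n {f g : ℕ → ℚ} → (∀ i → f i ≡ g i) → sumFrom1 n f ≡ sumFrom1 n g
sumFrom1-cong zero    f≡g = refl
sumFrom1-cong (suc n) f≡g = cong₂ _+_ (sumFrom1-cong n f≡g) (f≡g (suc n))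

sumFrom0-cong : ∀ n {f g : ℕ → ℚ} → (∀ i → f i ≡ g i) → sumFrom0 n f ≡ sumFrom0 n g
sumFrom0-cong n f≡g = cong₂ _+_ (f≡g 0) (sumFrom1-cong n f≡g)

∑-if : ∀ (b : Bool) n (f : ℕ → ℚ) → (if b then ∑ n f else 0ℚ) ≡ ∑[ i < n ] (if b then f i else 0ℚ)
∑-if true  n f = refl
∑-if false n f = sym (∑-zero n)

*-if : ∀ (b : Bool) c u → c * (if b then u else 0ℚ) ≡ (if b then c * u else 0ℚ)
*-if true  c u = refl
*-if false c u = *-zeroʳ c

∑-∑-comm-* : ∀ D t (a : ℕ → ℚ) (b : ℕ → ℚ) (c : ℕ → ℕ → ℚ) →
             ∑[ d < D ] a d * (∑[ j < t ] b j * c d j) ≡ ∑[ j < t ] b j * (∑[ d < D ] a d * c d j)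
∑-∑-comm-* D t a b c = begin
  ∑[ d < D ] a d * (∑[ j < t ] b j * c d j) ≡⟨ ∑-cong D (λ d → *-distribˡ-∑ t (a d) _) ⟩
  ∑[ d < D ] ∑[ j < t ] a d * (b j * c d j)   ≡⟨ ∑-cong D (λ d → ∑-cong t (λ j → swap (a d) (b j) (c d j))) ⟩
  ∑[ d < D ] ∑[ j < t ] b j * (a d * c d j)   ≡⟨ ∑-comm D t _ ⟩
  ∑[ j < t ] ∑[ d < D ] b j * (a d * c d j)   ≡⟨ ∑-cong t (λ j → sym (*-distribˡ-∑ D (b j) _)) ⟩
  ∑[ j < t ] b j * (∑[ d < D ] a d * c d j) ∎
  where
  open ≡-Reasoning
  swap : ∀ a b c → a * (b * c) ≡ b * (a * c)
  swap = solve 3 (λ a b c → a :* (b :* c) := b :* (a :* c)) refl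

∑ₗ : {A : Set} → List A → (A → ℚ) → ℚ
∑ₗ L f = sumList (map f L)

∑ₗ-cong : {A : Set} (L : List A) {f g : A → ℚ} → (∀ a → f a ≡ g a) → ∑ₗ L f ≡ ∑ₗ L g
∑ₗ-cong []      f≡g = refl
∑ₗ-cong (a ∷ L) f≡g = cong₂ _+_ (f≡g a) (∑ₗ-cong L f≡g)

∑ₗ-zero : {A : Set} (L : List A) → ∑ₗ L (λ _ → 0ℚ) ≡ 0ℚ
∑ₗ-zero []      = refl
∑ₗ-zero (a ∷ L) = trans (+-identityˡ _) (∑ₗ-zero L)

∑ₗ-++ : {A : Set} (L M : List A) (f : A → ℚ) → ∑ₗ (L ++ M) f ≡ ∑ₗ L f + ∑ₗ M f
∑ₗ-++ []      M f = sym (+-identityˡ _)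
∑ₗ-++ (a ∷ L) M f = trans (cong (f a +_) (∑ₗ-++ L M f)) (sym (+-assoc (f a) _ _))

∑ₗ-concatMap : {A B : Set} (g : A → List B) (L : List A) (f : B → ℚ) →
               ∑ₗ (concatMap g L) f ≡ ∑ₗ L (λ a → ∑ₗ (g a) f)
∑ₗ-concatMap g []      f = refl
∑ₗ-concatMap g (a ∷ L) f =
  trans (∑ₗ-++ (g a) (concatMap g L) f) (cong (∑ₗ (g a) f +_) (∑ₗ-concatMap g L f))

∑ₗ-∑-comm : {A : Set} (L : List A) (n : ℕ) (f : A → ℕ → ℚ) →
            ∑ₗ L (λ a → ∑ n (f a)) ≡ ∑[ i < n ] ∑ₗ L (λ a → f a i)
∑ₗ-∑-comm []      n f = sym (∑-zero n)
∑ₗ-∑-comm (a ∷ L) n f =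
  trans (cong (∑ n (f a) +_) (∑ₗ-∑-comm L n f)) (sym (∑-distrib-+ n (f a) _))

*-distribˡ-∑ₗ : {A : Set} (L : List A) (c : ℚ) (f : A → ℚ) → c * ∑ₗ L f ≡ ∑ₗ L (λ a → c * f a)
*-distribˡ-∑ₗ []      c f = *-zeroʳ c
*-distribˡ-∑ₗ (a ∷ L) c f =
  trans (*-distribˡ-+ c (f a) _) (cong (c * f a +_) (*-distribˡ-∑ₗ L c f))

^q-identityʳ : ∀ p → p ^q 1 ≡ p
^q-identityʳ = *-identityʳ

^q-distribˡ-+-* : ∀ p a b → p ^q (a ℕ.+ b) ≡ p ^q a * p ^q b
^q-distribˡ-+-* p zero    b = sym (*-identityˡ _)
^q-distribˡ-+-* p (suc a) b = trans (cong (p *_) (^q-distribˡ-+-* p a b)) (sym (*-assoc p _ _))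

two*≡+ : ∀ z → two * z ≡ z + z
two*≡+ z = trans (*-distribʳ-+ z 1ℚ 1ℚ) (cong₂ _+_ (*-identityˡ z) (*-identityˡ z))

-- Compositions

-- `vecs` extends lists through a helper local to its definition, reachable only as this witness.
vecs-suc : ∀ d → Σ (ℕ → List ℕ → List (List ℕ)) λ extend →
           ∀ B → vecs (suc d) B ≡ concatMap (extend B) (vecs d B)
vecs-suc d = _ , λ B → refl

∑ₗ-vecs-suc : ∀ d B (f : List ℕ → ℚ) →
              ∑ₗ (vecs (suc d) B) f ≡ ∑ₗ (vecs d B) (λ r → ∑[ i < B ] f (suc i ∷ r))
∑ₗ-vecs-suc d B f = trans (cong (λ L → ∑ₗ L f) (proj₂ (vecs-suc d) B))
  (trans (∑ₗ-concatMap (proj₁ (vecs-suc d) B) (vecs d B) f) (∑ₗ-cong (vecs d B) (∑ₗ-extend B)))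
  where
  ∑ₗ-extend : ∀ B r → ∑ₗ (proj₁ (vecs-suc d) B r) f ≡ ∑[ i < B ] f (suc i ∷ r)
  ∑ₗ-extend zero    r = refl
  ∑ₗ-extend (suc B) r = trans (cong (f (suc B ∷ r) +_) (∑ₗ-extend B r)) (+-comm (f (suc B ∷ r)) _)

+-≡ᵇ-∸ : ∀ j u t → j ℕ.≤ t → (j ℕ.+ u ℕ.≡ᵇ t) ≡ (u ℕ.≡ᵇ t ∸ j)
+-≡ᵇ-∸ zero    u t       _         = refl
+-≡ᵇ-∸ (suc j) u (suc t) (s≤s j≤t) = +-≡ᵇ-∸ j u t j≤t

+-≡ᵇ-> : ∀ j u t → t ℕ.< j → (j ℕ.+ u ℕ.≡ᵇ t) ≡ false
+-≡ᵇ-> (suc j) u zero    _         = refl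
+-≡ᵇ-> (suc j) u (suc t) (s≤s t<j) = +-≡ᵇ-> j u t t<j

admissible-1∷ : ∀ w r → admissible w (1 ∷ r) ≡ false
admissible-1∷ w r with suc (total r) ℕ.≡ᵇ w
... | true  = refl
... | false = refl

admissible-2+∷ : ∀ w i r → admissible w (suc (suc i) ∷ r) ≡ (suc (suc i) ℕ.+ total r ℕ.≡ᵇ w)
admissible-2+∷ w i r with suc (suc i) ℕ.+ total r ℕ.≡ᵇ w
... | true  = refl
... | false = refl

ΣComp-cong : ∀ d w {F G : List ℕ → ℚ} → (∀ s → F s ≡ G s) → ΣComp d w F ≡ ΣComp d w G
ΣComp-cong d w F≡G = ∑ₗ-cong (vecs d w) (λ s → cong (if admissible w s then_else 0ℚ) (F≡G s))

ΣComp-∑-comm : ∀ d w N (f : List ℕ → ℕ → ℚ) →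
               ΣComp d w (λ s → ∑ N (f s)) ≡ ∑[ n < N ] ΣComp d w (λ s → f s n)
ΣComp-∑-comm d w N f =
  trans (∑ₗ-cong (vecs d w) (λ s → ∑-if (admissible w s) N (f s))) (∑ₗ-∑-comm (vecs d w) N _)

*-distribˡ-ΣComp : ∀ d w c (F : List ℕ → ℚ) → c * ΣComp d w F ≡ ΣComp d w (λ s → c * F s)
*-distribˡ-ΣComp d w c F =
  trans (*-distribˡ-∑ₗ (vecs d w) c _) (∑ₗ-cong (vecs d w) (λ s → *-if (admissible w s) c (F s)))

-- Symmetric functions of a weight sequence x₁, x₂, …

module SymmetricFunctions (x : ℕ → ℚ) where

  Z : ℕ → List ℕ → ℚ
  Z n []       = 1ℚ
  Z n (k ∷ ks) = sumFrom1 n (λ a → (x a ^q k) * Z (ℕ.pred a) ks)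

  Z⋆ : ℕ → List ℕ → ℚ
  Z⋆ n []       = 1ℚ
  Z⋆ n (k ∷ ks) = sumFrom1 n (λ a → (x a ^q k) * Z⋆ a ks)

  Z-∷ : ∀ n k ks → Z n (k ∷ ks) ≡ ∑[ a < n ] x (suc a) ^q k * Z a ks
  Z-∷ n k ks = sumFrom1≡∑ n _

  Z⋆-∷ : ∀ n k ks → Z⋆ n (k ∷ ks) ≡ ∑[ a < n ] x (suc a) ^q k * Z⋆ (suc a) ks
  Z⋆-∷ n k ks = sumFrom1≡∑ n _

  e : ℕ → ℕ → ℚ
  e n r = Z n (ones r)

  h : ℕ → ℕ → ℚ
  h n k = Z⋆ n (ones k)

  e-suc : ∀ n r → e (suc n) (suc r) ≡ e n (suc r) + x (suc n) * e n r
  e-suc n r = cong (λ z → e n (suc r) + z * e n r) (^q-identityʳ (x (suc n)))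

  h-suc : ∀ n k → h (suc n) (suc k) ≡ h n (suc k) + x (suc n) * h (suc n) k
  h-suc n k = cong (λ z → h n (suc k) + z * h (suc n) k) (^q-identityʳ (x (suc n)))

  eh : ℕ → ℕ → ℚ
  eh n t = ∑[ k < suc t ] e n (t ∸ k) * h n k

  eh⁺ : ℕ → ℕ → ℚ
  eh⁺ n t = ∑[ k < suc t ] e n (t ∸ k) * h (suc n) k

  eh⁺-suc : ∀ n t → eh⁺ n (suc t) ≡ eh n (suc t) + x (suc n) * eh⁺ n t
  eh⁺-suc n t = begin
    eh⁺ n (suc t)
      ≡⟨ ∑-suc (suc t) _ ⟩
    e n (suc t) * 1ℚ + (∑[ k < suc t ] e n (t ∸ k) * h (suc n) (suc k))
      ≡⟨ cong (e n (suc t) * 1ℚ +_) (∑-cong (suc t) (λ k → split (e n (t ∸ k)) (h-suc n k))) ⟩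
    e n (suc t) * 1ℚ + (∑[ k < suc t ] e n (t ∸ k) * h n (suc k) + y * (e n (t ∸ k) * h (suc n) k))
      ≡⟨ cong (e n (suc t) * 1ℚ +_) (∑-distrib-+ (suc t) _ _) ⟩
    e n (suc t) * 1ℚ + ((∑[ k < suc t ] e n (t ∸ k) * h n (suc k))
                       + (∑[ k < suc t ] y * (e n (t ∸ k) * h (suc n) k)))
      ≡⟨ sym (+-assoc (e n (suc t) * 1ℚ) _ _) ⟩
    (e n (suc t) * 1ℚ + (∑[ k < suc t ] e n (t ∸ k) * h n (suc k)))
      + (∑[ k < suc t ] y * (e n (t ∸ k) * h (suc n) k))
      ≡⟨ cong₂ _+_ (sym (∑-suc (suc t) _)) (sym (*-distribˡ-∑ (suc t) y _)) ⟩
    eh n (suc t) + y * eh⁺ n t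
      ∎
    where
    open ≡-Reasoning
    y = x (suc n)
    split : ∀ a {b c w} → b ≡ c + y * w → a * b ≡ a * c + y * (a * w)
    split a {c = c} {w} b≡ = trans (cong (a *_) b≡) (distrib a c y w)
      where
      distrib : ∀ a c y w → a * (c + y * w) ≡ a * c + y * (a * w)
      distrib = solve 4 (λ a c y w → a :* (c :+ y :* w) := a :* c :+ y :* (a :* w)) refl

  eh⁺-geometric : ∀ n t → eh⁺ n t ≡ ∑[ i < suc t ] x (suc n) ^q i * eh n (t ∸ i)
  eh⁺-geometric n zero    = refl
  eh⁺-geometric n (suc t) = begin
    eh⁺ n (suc t)
      ≡⟨ eh⁺-suc n t ⟩
    eh n (suc t) + y * eh⁺ n t
      ≡⟨ cong₂ _+_ (sym (*-identityˡ (eh n (suc t)))) (cong (y *_) (eh⁺-geometric n t)) ⟩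
    1ℚ * eh n (suc t) + y * (∑[ i < suc t ] y ^q i * eh n (t ∸ i))
      ≡⟨ cong (1ℚ * eh n (suc t) +_) (*-distribˡ-∑ (suc t) y _) ⟩
    1ℚ * eh n (suc t) + (∑[ i < suc t ] y * (y ^q i * eh n (t ∸ i)))
      ≡⟨ cong (1ℚ * eh n (suc t) +_) (∑-cong (suc t) (λ i → sym (*-assoc y _ _))) ⟩
    1ℚ * eh n (suc t) + (∑[ i < suc t ] y ^q suc i * eh n (t ∸ i))
      ≡⟨ sym (∑-suc (suc t) _) ⟩
    ∑[ i < suc (suc t) ] y ^q i * eh n (suc t ∸ i)
      ∎
    where
    open ≡-Reasoning
    y = x (suc n)

  eh-suc : ∀ n t → eh (suc n) (suc t) ≡ eh⁺ n (suc t) + x (suc n) * eh⁺ n t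
  eh-suc n t = begin
    eh (suc n) (suc t)
      ≡⟨ cong₂ _+_ (∑-cong-< (suc t) (λ k k<1+t → cong (_* h (suc n) k) (e-suc-∸ (ℕₚ.≤-pred k<1+t)))) last ⟩
    (∑[ k < suc t ] (e n (suc t ∸ k) + y * e n (t ∸ k)) * h (suc n) k) + e n (t ∸ t) * h (suc n) (suc t)
      ≡⟨ cong (_+ e n (t ∸ t) * h (suc n) (suc t))
              (trans (∑-cong (suc t) (λ k → distrib (e n (suc t ∸ k)) y (e n (t ∸ k)) (h (suc n) k)))
                     (∑-distrib-+ (suc t) _ _)) ⟩
    ((∑[ k < suc t ] e n (suc t ∸ k) * h (suc n) k) + (∑[ k < suc t ] y * (e n (t ∸ k) * h (suc n) k)))
      + e n (t ∸ t) * h (suc n) (suc t)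
      ≡⟨ +-right-comm (∑[ k < suc t ] e n (suc t ∸ k) * h (suc n) k) _ _ ⟩
    eh⁺ n (suc t) + (∑[ k < suc t ] y * (e n (t ∸ k) * h (suc n) k))
      ≡⟨ cong (eh⁺ n (suc t) +_) (sym (*-distribˡ-∑ (suc t) y _)) ⟩
    eh⁺ n (suc t) + y * eh⁺ n t
      ∎
    where
    open ≡-Reasoning
    y = x (suc n)
    e-suc-∸ : ∀ {k} → k ℕ.≤ t → e (suc n) (suc t ∸ k) ≡ e n (suc t ∸ k) + y * e n (t ∸ k)
    e-suc-∸ {k} k≤t rewrite ℕₚ.+-∸-assoc 1 k≤t = e-suc n (t ∸ k)
    last : e (suc n) (t ∸ t) * h (suc n) (suc t) ≡ e n (t ∸ t) * h (suc n) (suc t)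
    last rewrite ℕₚ.n∸n≡0 t = refl
    distrib : ∀ a y b c → (a + y * b) * c ≡ a * c + y * (b * c)
    distrib = solve 4 (λ a y b c → (a :+ y :* b) :* c := a :* c :+ y :* (b :* c)) refl
    +-right-comm : ∀ a b c → (a + b) + c ≡ (a + c) + b
    +-right-comm = solve 3 (λ a b c → (a :+ b) :+ c := (a :+ c) :+ b) refl

  eh-recurrence : ∀ n t → eh (suc n) t ≡ eh n t + two * (∑[ j < t ] x (suc n) ^q suc j * eh n (t ∸ suc j))
  eh-recurrence n zero    = refl
  eh-recurrence n (suc t) = begin
    eh (suc n) (suc t)                             ≡⟨ eh-suc n t ⟩
    eh⁺ n (suc t) + y * eh⁺ n t                    ≡⟨ cong (_+ y * eh⁺ n t) (eh⁺-suc n t) ⟩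
    (eh n (suc t) + y * eh⁺ n t) + y * eh⁺ n t     ≡⟨ +-assoc (eh n (suc t)) _ _ ⟩
    eh n (suc t) + (y * eh⁺ n t + y * eh⁺ n t)     ≡⟨ cong (eh n (suc t) +_) (sym (two*≡+ (y * eh⁺ n t))) ⟩
    eh n (suc t) + two * (y * eh⁺ n t)             ≡⟨ cong (λ z → eh n (suc t) + two * z) geometric ⟩
    eh n (suc t) + two * (∑[ j < suc t ] y ^q suc j * eh n (t ∸ j)) ∎
    where
    open ≡-Reasoning
    y = x (suc n)
    geometric : y * eh⁺ n t ≡ ∑[ j < suc t ] y ^q suc j * eh n (t ∸ j)
    geometric = trans (cong (y *_) (eh⁺-geometric n t))
                      (trans (*-distribˡ-∑ (suc t) y _) (∑-cong (suc t) (λ j → sym (*-assoc y _ _))))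

  -- compSum d t n sums ∏ᵢ x_{aᵢ}^{jᵢ} over compositions (j₁,…,j_d) of t and n ≥ a₁ > ⋯ > a_d ≥ 1.
  compSum : ℕ → ℕ → ℕ → ℚ
  compSum zero    t n = if t ℕ.≡ᵇ 0 then 1ℚ else 0ℚ
  compSum (suc d) t n = ∑[ j < t ] ∑[ a < n ] x (suc a) ^q suc j * compSum d (t ∸ suc j) a

  compSum-suc : ∀ d t n → compSum (suc d) t (suc n) ≡
                compSum (suc d) t n + (∑[ j < t ] x (suc n) ^q suc j * compSum d (t ∸ suc j) n)
  compSum-suc d t n = ∑-distrib-+ t _ _

  compGen : ℕ → ℕ → ℕ → ℚ
  compGen D t n = ∑[ d < suc D ] two ^q d * compSum d t n

  compGen-zero : ∀ D t → compGen D t 0 ≡ compSum 0 t 0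
  compGen-zero D t = begin
    compGen D t 0
      ≡⟨ ∑-suc D _ ⟩
    1ℚ * compSum 0 t 0 + (∑[ d < D ] two ^q suc d * compSum (suc d) t 0)
      ≡⟨ cong₂ _+_ (*-identityˡ (compSum 0 t 0))
                   (trans (∑-cong D (λ d → trans (cong (two ^q suc d *_) (∑-zero t)) (*-zeroʳ (two ^q suc d)))) (∑-zero D)) ⟩
    compSum 0 t 0 + 0ℚ
      ≡⟨ +-identityʳ _ ⟩
    compSum 0 t 0
      ∎
    where open ≡-Reasoning

  compGen-suc : ∀ D t n → compGen (suc D) t (suc n) ≡
                compGen (suc D) t n + two * (∑[ j < t ] x (suc n) ^q suc j * compGen D (t ∸ suc j) n)
  compGen-suc D t n = begin
    compGen (suc D) t (suc n)
      ≡⟨ ∑-suc (suc D) _ ⟩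
    c₀ + (∑[ d < suc D ] two ^q suc d * compSum (suc d) t (suc n))
      ≡⟨ cong (c₀ +_) (trans (∑-cong (suc D) (λ d → trans (cong (two ^q suc d *_) (compSum-suc d t n))
                                                          (*-distribˡ-+ (two ^q suc d) _ (S d))))
                             (∑-distrib-+ (suc D) (λ d → two ^q suc d * compSum (suc d) t n)
                                                  (λ d → two ^q suc d * S d))) ⟩
    c₀ + ((∑[ d < suc D ] two ^q suc d * compSum (suc d) t n) + (∑[ d < suc D ] two ^q suc d * S d))
      ≡⟨ sym (+-assoc c₀ _ _) ⟩
    (c₀ + (∑[ d < suc D ] two ^q suc d * compSum (suc d) t n)) + (∑[ d < suc D ] two ^q suc d * S d)
      ≡⟨ cong₂ _+_ (sym (∑-suc (suc D) _)) scaled ⟩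
    compGen (suc D) t n + two * (∑[ j < t ] y ^q suc j * compGen D (t ∸ suc j) n)
      ∎
    where
    open ≡-Reasoning
    y = x (suc n)
    c₀ = two ^q 0 * compSum 0 t n
    S : ℕ → ℚ
    S d = ∑[ j < t ] y ^q suc j * compSum d (t ∸ suc j) n
    scaled : (∑[ d < suc D ] two ^q suc d * S d) ≡ two * (∑[ j < t ] y ^q suc j * compGen D (t ∸ suc j) n)
    scaled = trans (∑-cong (suc D) (λ d → *-assoc two (two ^q d) (S d)))
             (trans (sym (*-distribˡ-∑ (suc D) two (λ d → two ^q d * S d)))
                    (cong (two *_) (∑-∑-comm-* (suc D) t (two ^q_) (λ j → y ^q suc j)
                                                          (λ d j → compSum d (t ∸ suc j) n))))

  eh-zero : ∀ t → eh 0 t ≡ compSum 0 t 0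
  eh-zero zero    = refl
  eh-zero (suc t) = trans (∑-suc (suc t) _)
    (cong (0ℚ * 1ℚ +_) (trans (∑-cong (suc t) (λ k → *-zeroʳ (e 0 (t ∸ k)))) (∑-zero (suc t))))

  compGen≡eh : ∀ n D t → t ℕ.≤ D → compGen D t n ≡ eh n t
  compGen≡eh zero    D       t    _   = trans (compGen-zero D t) (sym (eh-zero t))
  compGen≡eh (suc n) zero    zero _   = refl
  compGen≡eh (suc n) (suc D) t    t≤D = begin
    compGen (suc D) t (suc n)
      ≡⟨ compGen-suc D t n ⟩
    compGen (suc D) t n + two * (∑[ j < t ] y ^q suc j * compGen D (t ∸ suc j) n)
      ≡⟨ cong₂ (λ u v → u + two * v) (compGen≡eh n (suc D) t t≤D)
               (∑-cong t (λ j → cong (y ^q suc j *_) (compGen≡eh n D (t ∸ suc j) (t∸1+j≤D j)))) ⟩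
    eh n t + two * (∑[ j < t ] y ^q suc j * eh n (t ∸ suc j))
      ≡⟨ sym (eh-recurrence n t) ⟩
    eh (suc n) t
      ∎
    where
    open ≡-Reasoning
    y = x (suc n)
    t∸1+j≤D : ∀ j → t ∸ suc j ℕ.≤ D
    t∸1+j≤D j = ℕₚ.≤-trans (ℕₚ.∸-monoˡ-≤ (suc j) t≤D) (ℕₚ.m∸n≤m D j)

  eh⁺≡∑compGen : ∀ n m → eh⁺ n m ≡ ∑[ i < suc m ] x (suc n) ^q i * compGen m (m ∸ i) n
  eh⁺≡∑compGen n m = trans (eh⁺-geometric n m)
    (∑-cong (suc m) (λ i → cong (x (suc n) ^q i *_) (sym (compGen≡eh n m (m ∸ i) (ℕₚ.m∸n≤m m i)))))

  compSumₗ : ℕ → ℕ → ℕ → ℕ → ℚ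
  compSumₗ d B t n = ∑ₗ (vecs d B) (λ r → if total r ℕ.≡ᵇ t then Z n r else 0ℚ)

  compSumₗ-head : ∀ d B t n i → suc i ℕ.≤ t →
                  ∑ₗ (vecs d B) (λ r → if suc i ℕ.+ total r ℕ.≡ᵇ t then Z n (suc i ∷ r) else 0ℚ)
                  ≡ ∑[ a < n ] x (suc a) ^q suc i * compSumₗ d B (t ∸ suc i) a
  compSumₗ-head d B t n i 1+i≤t = begin
    ∑ₗ (vecs d B) (λ r → if suc i ℕ.+ total r ℕ.≡ᵇ t then Z n (suc i ∷ r) else 0ℚ)
      ≡⟨ ∑ₗ-cong (vecs d B) pull ⟩
    ∑ₗ (vecs d B) (λ r → ∑[ a < n ] x (suc a) ^q suc i * (if total r ℕ.≡ᵇ t ∸ suc i then Z a r else 0ℚ))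
      ≡⟨ ∑ₗ-∑-comm (vecs d B) n _ ⟩
    ∑[ a < n ] ∑ₗ (vecs d B) (λ r → x (suc a) ^q suc i * (if total r ℕ.≡ᵇ t ∸ suc i then Z a r else 0ℚ))
      ≡⟨ ∑-cong n (λ a → sym (*-distribˡ-∑ₗ (vecs d B) (x (suc a) ^q suc i) _)) ⟩
    ∑[ a < n ] x (suc a) ^q suc i * compSumₗ d B (t ∸ suc i) a
      ∎
    where
    open ≡-Reasoning
    pull : ∀ r → (if suc i ℕ.+ total r ℕ.≡ᵇ t then Z n (suc i ∷ r) else 0ℚ)
               ≡ ∑[ a < n ] x (suc a) ^q suc i * (if total r ℕ.≡ᵇ t ∸ suc i then Z a r else 0ℚ)
    pull r rewrite +-≡ᵇ-∸ (suc i) (total r) t 1+i≤t =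
      trans (cong (if total r ℕ.≡ᵇ t ∸ suc i then_else 0ℚ) (Z-∷ n (suc i) r))
     (trans (∑-if (total r ℕ.≡ᵇ t ∸ suc i) n _)
            (∑-cong n (λ a → sym (*-if (total r ℕ.≡ᵇ t ∸ suc i) (x (suc a) ^q suc i) (Z a r)))))

  compSumₗ≡compSum : ∀ d B t n → t ℕ.≤ B → compSumₗ d B t n ≡ compSum d t n
  compSumₗ≡compSum zero    B zero    n _   = refl
  compSumₗ≡compSum zero    B (suc t) n _   = refl
  compSumₗ≡compSum (suc d) B t       n t≤B = begin
    compSumₗ (suc d) B t n
      ≡⟨ ∑ₗ-vecs-suc d B _ ⟩
    ∑ₗ (vecs d B) (λ r → ∑[ i < B ] F i r)
      ≡⟨ ∑ₗ-∑-comm (vecs d B) B _ ⟩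
    ∑[ i < B ] ∑ₗ (vecs d B) (F i)
      ≡⟨ ∑-truncate B _ t≤B (λ i t≤i →
           trans (∑ₗ-cong (vecs d B) (λ r → too-long i r t≤i)) (∑ₗ-zero (vecs d B))) ⟩
    ∑[ i < t ] ∑ₗ (vecs d B) (F i)
      ≡⟨ ∑-cong-< t (λ i i<t → trans (compSumₗ-head d B t n i i<t)
            (∑-cong n (λ a → cong (x (suc a) ^q suc i *_)
               (compSumₗ≡compSum d B (t ∸ suc i) a (ℕₚ.≤-trans (ℕₚ.m∸n≤m t (suc i)) t≤B))))) ⟩
    compSum (suc d) t n
      ∎
    where
    open ≡-Reasoning
    F : ℕ → List ℕ → ℚ
    F i r = if suc i ℕ.+ total r ℕ.≡ᵇ t then Z n (suc i ∷ r) else 0ℚ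
    too-long : ∀ i r → t ℕ.≤ i → F i r ≡ 0ℚ
    too-long i r t≤i rewrite +-≡ᵇ-> (suc i) (total r) t (s≤s t≤i) = refl

  -- The summand of ζ(shiftHead l s; η, 1, …) at n₁ = n + 1, without its factor η^(n+1).
  headTerm : ℕ → ℕ → List ℕ → ℚ
  headTerm l n []      = 0ℚ
  headTerm l n (j ∷ r) = x (suc n) ^q (j ℕ.+ l ∸ 2) * Z n r

  ΣComp-headTerm : ∀ l n m d → ΣComp (suc d) (m ℕ.+ 2) (headTerm l n)
                   ≡ ∑[ i < suc m ] x (suc n) ^q (i ℕ.+ l) * compSum d (m ∸ i) n
  ΣComp-headTerm l n m d = begin
    ΣComp (suc d) (m ℕ.+ 2) (headTerm l n)
      ≡⟨ cong (λ w → ΣComp (suc d) w (headTerm l n)) (ℕₚ.+-comm m 2) ⟩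
    ΣComp (suc d) W (headTerm l n)
      ≡⟨ trans (∑ₗ-vecs-suc d W _) (∑ₗ-∑-comm (vecs d W) W _) ⟩
    ∑[ i < W ] ∑ₗ (vecs d W) (λ r → G (suc i ∷ r))
      ≡⟨ ∑-suc (suc m) _ ⟩
    ∑ₗ (vecs d W) (λ r → G (1 ∷ r)) + (∑[ i < suc m ] ∑ₗ (vecs d W) (λ r → G (suc (suc i) ∷ r)))
      ≡⟨ cong₂ _+_ (trans (∑ₗ-cong (vecs d W) (λ r → cong (if_then _ else 0ℚ) (admissible-1∷ W r)))
                          (∑ₗ-zero (vecs d W)))
                   (∑-cong-< (suc m) (λ i i<1+m → admissible-part i (ℕₚ.≤-pred i<1+m))) ⟩
    0ℚ + (∑[ i < suc m ] y ^q (i ℕ.+ l) * compSum d (m ∸ i) n)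
      ≡⟨ +-identityˡ _ ⟩
    ∑[ i < suc m ] y ^q (i ℕ.+ l) * compSum d (m ∸ i) n
      ∎
    where
    open ≡-Reasoning
    y = x (suc n)
    W = suc (suc m)
    G : List ℕ → ℚ
    G s = if admissible W s then headTerm l n s else 0ℚ
    admissible-part : ∀ i → i ℕ.≤ m →
                      ∑ₗ (vecs d W) (λ r → G (suc (suc i) ∷ r)) ≡ y ^q (i ℕ.+ l) * compSum d (m ∸ i) n
    admissible-part i i≤m = begin
      ∑ₗ (vecs d W) (λ r → G (suc (suc i) ∷ r))
        ≡⟨ ∑ₗ-cong (vecs d W) (λ r → trans (cong (if_then _ else 0ℚ)
             (trans (admissible-2+∷ W i r) (+-≡ᵇ-∸ (suc (suc i)) (total r) W (s≤s (s≤s i≤m)))))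
             (sym (*-if (total r ℕ.≡ᵇ m ∸ i) (y ^q (i ℕ.+ l)) (Z n r)))) ⟩
      ∑ₗ (vecs d W) (λ r → y ^q (i ℕ.+ l) * (if total r ℕ.≡ᵇ m ∸ i then Z n r else 0ℚ))
        ≡⟨ sym (*-distribˡ-∑ₗ (vecs d W) (y ^q (i ℕ.+ l)) _) ⟩
      y ^q (i ℕ.+ l) * compSumₗ d W (m ∸ i) n
        ≡⟨ cong (y ^q (i ℕ.+ l) *_)
                (compSumₗ≡compSum d W (m ∸ i) n (ℕₚ.≤-trans (ℕₚ.m∸n≤m m i) (ℕₚ.m≤n+m m 2))) ⟩
      y ^q (i ℕ.+ l) * compSum d (m ∸ i) n
        ∎

  lhsTerm : ℚ → ℕ → ℕ → ℕ → ℚ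
  lhsTerm η m l n = η ^q n * x (suc n) ^q l * eh⁺ n m

  rhsTerm : ℚ → ℕ → ℕ → ℕ → ℚ
  rhsTerm η m l n = η * (∑[ d < suc m ] two ^q d * (η ^q suc n * ΣComp (suc d) (m ℕ.+ 2) (headTerm l n)))

  rhsTerm≡lhsTerm : ∀ η m l n → η * η ≡ 1ℚ → rhsTerm η m l n ≡ lhsTerm η m l n
  rhsTerm≡lhsTerm η m l n η²≡1 = begin
    rhsTerm η m l n
      ≡⟨ cong (η *_) (trans (∑-cong (suc m) (λ d → swap (two ^q d) (η ^q suc n) _))
                            (sym (*-distribˡ-∑ (suc m) (η ^q suc n) _))) ⟩
    η * (η ^q suc n * (∑[ d < suc m ] two ^q d * ΣComp (suc d) (m ℕ.+ 2) (headTerm l n)))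
      ≡⟨ trans (sym (*-assoc η (η ^q suc n) _)) (cong (_* _) η*η^1+n) ⟩
    η ^q n * (∑[ d < suc m ] two ^q d * ΣComp (suc d) (m ℕ.+ 2) (headTerm l n))
      ≡⟨ cong (η ^q n *_) (∑-cong (suc m) (λ d → cong (two ^q d *_) (ΣComp-headTerm l n m d))) ⟩
    η ^q n * (∑[ d < suc m ] two ^q d * (∑[ i < suc m ] y ^q (i ℕ.+ l) * compSum d (m ∸ i) n))
      ≡⟨ cong (η ^q n *_) (∑-∑-comm-* (suc m) (suc m) (two ^q_) (λ i → y ^q (i ℕ.+ l))
                                       (λ d i → compSum d (m ∸ i) n)) ⟩
    η ^q n * (∑[ i < suc m ] y ^q (i ℕ.+ l) * compGen m (m ∸ i) n)
      ≡⟨ cong (η ^q n *_) (trans (∑-cong (suc m) split-power) (sym (*-distribˡ-∑ (suc m) (y ^q l) _))) ⟩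
    η ^q n * (y ^q l * (∑[ i < suc m ] y ^q i * compGen m (m ∸ i) n))
      ≡⟨ cong (λ z → η ^q n * (y ^q l * z)) (sym (eh⁺≡∑compGen n m)) ⟩
    η ^q n * (y ^q l * eh⁺ n m)
      ≡⟨ sym (*-assoc (η ^q n) _ _) ⟩
    lhsTerm η m l n
      ∎
    where
    open ≡-Reasoning
    y = x (suc n)
    swap : ∀ a b c → a * (b * c) ≡ b * (a * c)
    swap = solve 3 (λ a b c → a :* (b :* c) := b :* (a :* c)) refl
    η*η^1+n : η * η ^q suc n ≡ η ^q n
    η*η^1+n = trans (sym (*-assoc η η _)) (trans (cong (_* η ^q n) η²≡1) (*-identityˡ (η ^q n)))
    split-power : ∀ i → y ^q (i ℕ.+ l) * compGen m (m ∸ i) n ≡ y ^q l * (y ^q i * compGen m (m ∸ i) n)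
    split-power i = trans (cong (_* compGen m (m ∸ i) n) (trans (^q-distribˡ-+-* y i l) (*-comm (y ^q i) (y ^q l))))
                          (*-assoc (y ^q l) (y ^q i) _)

  ZPartial : ℚ → ℕ → List ℕ → ℚ
  ZPartial η N []        = 0ℚ
  ZPartial η N (s₁ ∷ ss) = sumFrom1 N (λ n₁ → (η ^q n₁) * (x n₁ ^q s₁) * Z (ℕ.pred n₁) ss)

  lhsPartial : ℚ → ℕ → ℕ → ℕ → ℚ
  lhsPartial η m l N = sumFrom0 m (λ k → sumFrom0 N (λ n →
    (η ^q n) * e n (m ∸ k) * h (suc n) k * (x (suc n) ^q l)))

  rhsPartial : ℚ → ℕ → ℕ → ℕ → ℚ
  rhsPartial η m l N = η * sumFrom1 (suc m) (λ d → ΣComp d (m ℕ.+ 2) (λ s →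
    (two ^q (ℕ.pred d)) * ZPartial η N (shiftHead l s)))

  ZPartial-shiftHead : ∀ η l N s → ZPartial η N (shiftHead l s) ≡ ∑[ n < N ] η ^q suc n * headTerm l n s
  ZPartial-shiftHead η l N []      = sym (trans (∑-cong N (λ n → *-zeroʳ (η ^q suc n))) (∑-zero N))
  ZPartial-shiftHead η l N (j ∷ r) = trans (sumFrom1≡∑ N _) (∑-cong N (λ n → *-assoc (η ^q suc n) _ _))

  lhsPartial≡∑ : ∀ η m l N → lhsPartial η m l N ≡ ∑ (suc N) (lhsTerm η m l)
  lhsPartial≡∑ η m l N = begin
    lhsPartial η m l N
      ≡⟨ trans (sumFrom0≡∑ m _) (∑-cong (suc m) (λ k → sumFrom0≡∑ N _)) ⟩
    ∑[ k < suc m ] ∑[ n < suc N ] (η ^q n) * e n (m ∸ k) * h (suc n) k * (x (suc n) ^q l)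
      ≡⟨ ∑-comm (suc m) (suc N) _ ⟩
    ∑[ n < suc N ] ∑[ k < suc m ] (η ^q n) * e n (m ∸ k) * h (suc n) k * (x (suc n) ^q l)
      ≡⟨ ∑-cong (suc N) (λ n → trans (∑-cong (suc m) (λ k →
                                        regroup (η ^q n) (e n (m ∸ k)) (h (suc n) k) (x (suc n) ^q l)))
                                     (sym (*-distribˡ-∑ (suc m) (η ^q n * x (suc n) ^q l) _))) ⟩
    ∑ (suc N) (lhsTerm η m l)
      ∎
    where
    open ≡-Reasoning
    regroup : ∀ a b c d → a * b * c * d ≡ (a * d) * (b * c)
    regroup = solve 4 (λ a b c d → a :* b :* c :* d := (a :* d) :* (b :* c)) refl

  rhsPartial≡∑ : ∀ η m l N → rhsPartial η m l N ≡ ∑ N (rhsTerm η m l)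
  rhsPartial≡∑ η m l N = begin
    rhsPartial η m l N
      ≡⟨ cong (η *_) (sumFrom1≡∑ (suc m) _) ⟩
    η * (∑[ d < suc m ] ΣComp (suc d) W (λ s → two ^q d * ZPartial η N (shiftHead l s)))
      ≡⟨ cong (η *_) (∑-cong (suc m) (λ d → trans (ΣComp-cong (suc d) W (λ s →
           trans (cong (two ^q d *_) (ZPartial-shiftHead η l N s)) (*-distribˡ-∑ N (two ^q d) _)))
           (ΣComp-∑-comm (suc d) W N _))) ⟩
    η * (∑[ d < suc m ] ∑[ n < N ] ΣComp (suc d) W (λ s → two ^q d * (η ^q suc n * headTerm l n s)))
      ≡⟨ cong (η *_) (∑-cong (suc m) (λ d → ∑-cong N (λ n → sym (constants d n)))) ⟩
    η * (∑[ d < suc m ] ∑[ n < N ] two ^q d * (η ^q suc n * ΣComp (suc d) W (headTerm l n)))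
      ≡⟨ cong (η *_) (∑-comm (suc m) N _) ⟩
    η * (∑[ n < N ] ∑[ d < suc m ] two ^q d * (η ^q suc n * ΣComp (suc d) W (headTerm l n)))
      ≡⟨ *-distribˡ-∑ N η _ ⟩
    ∑ N (rhsTerm η m l)
      ∎
    where
    open ≡-Reasoning
    W = m ℕ.+ 2
    constants : ∀ d n → two ^q d * (η ^q suc n * ΣComp (suc d) W (headTerm l n))
                      ≡ ΣComp (suc d) W (λ s → two ^q d * (η ^q suc n * headTerm l n s))
    constants d n = trans (cong (two ^q d *_) (*-distribˡ-ΣComp (suc d) W (η ^q suc n) _))
                          (*-distribˡ-ΣComp (suc d) W (two ^q d) _)

  partial-difference : ∀ η m l N → η * η ≡ 1ℚ →
                       lhsPartial η m l N - rhsPartial η m l N ≡ lhsTerm η m l N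
  partial-difference η m l N η²≡1 = begin
    lhsPartial η m l N - rhsPartial η m l N
      ≡⟨ cong₂ _-_ (lhsPartial≡∑ η m l N)
                   (trans (rhsPartial≡∑ η m l N) (∑-cong N (λ n → rhsTerm≡lhsTerm η m l n η²≡1))) ⟩
    (∑ N (lhsTerm η m l) + lhsTerm η m l N) - ∑ N (lhsTerm η m l)
      ≡⟨ cancel (∑ N (lhsTerm η m l)) (lhsTerm η m l N) ⟩
    lhsTerm η m l N
      ∎
    where
    open ≡-Reasoning
    cancel : ∀ a b → (a + b) - a ≡ b
    cancel = solve 2 (λ a b → (a :+ b) :- a := b) refl

-- Growth estimates

fromℕ : ℕ → ℚ
fromℕ n = mkℚ (ℤ.+ n) 0 (Coprimality.sym (Coprimality.1-coprimeTo n))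

1/[1+_] : ℕ → ℚ
1/[1+ a ] = mkℚ (ℤ.+ 1) a (Coprimality.1-coprimeTo (suc a))

recip-suc : ∀ a → recip (suc a) ≡ 1/[1+ a ]
recip-suc a = normalize-coprime (Coprimality.1-coprimeTo (suc a))

recipOdd-suc : ∀ a → recipOdd (suc a) ≡ 1/[1+ 2 ℕ.* a ]
recipOdd-suc a = normalize-coprime (Coprimality.1-coprimeTo (suc (2 ℕ.* a)))

fromℕ-+ : ∀ a b → fromℕ a + fromℕ b ≡ fromℕ (a ℕ.+ b)
fromℕ-+ a b = trans (cong₂ (λ u v → (u ℤ.+ v) / 1) (ℤₚ.*-identityʳ (ℤ.+ a)) (ℤₚ.*-identityʳ (ℤ.+ b)))
                    (normalize-coprime (Coprimality.sym (Coprimality.1-coprimeTo (a ℕ.+ b))))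

fromℕ-* : ∀ a b → fromℕ a * fromℕ b ≡ fromℕ (a ℕ.* b)
fromℕ-* a b = trans (cong (_/ 1) (sym (ℤₚ.pos-* a b)))
                    (normalize-coprime (Coprimality.sym (Coprimality.1-coprimeTo (a ℕ.* b))))

fromℕ-suc : ∀ n → fromℕ (suc n) ≡ fromℕ n + 1ℚ
fromℕ-suc n = trans (cong fromℕ (ℕₚ.+-comm 1 n)) (sym (fromℕ-+ n 1))

fromℕ-^ : ∀ a k → fromℕ a ^q k ≡ fromℕ (a ^ k)
fromℕ-^ a zero    = refl
fromℕ-^ a (suc k) = trans (cong (fromℕ a *_) (fromℕ-^ a k)) (fromℕ-* a (a ^ k))

fromℕ-mono-≤ : ∀ {a b} → a ℕ.≤ b → fromℕ a ≤ fromℕ b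
fromℕ-mono-≤ {a} {b} a≤b =
  *≤* (subst₂ ℤ._≤_ (sym (ℤₚ.*-identityʳ (ℤ.+ a))) (sym (ℤₚ.*-identityʳ (ℤ.+ b))) (ℤ.+≤+ a≤b))

fromℕ-nonNeg : ∀ a → 0ℚ ≤ fromℕ a
fromℕ-nonNeg a = fromℕ-mono-≤ z≤n

fromℕ*1/[1+]≡1 : ∀ a → fromℕ (suc a) * 1/[1+ a ] ≡ 1ℚ
fromℕ*1/[1+]≡1 a = *-inverseʳ (fromℕ (suc a))

1/[1+]-antimono-≤ : ∀ {a b} → a ℕ.≤ b → 1/[1+ b ] ≤ 1/[1+ a ]
1/[1+]-antimono-≤ {a} {b} a≤b =
  *≤* (subst₂ ℤ._≤_ (sym (ℤₚ.*-identityˡ (ℤ.+ suc a))) (sym (ℤₚ.*-identityˡ (ℤ.+ suc b))) (ℤ.+≤+ (s≤s a≤b)))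

1/[1+]-nonNeg : ∀ a → 0ℚ ≤ 1/[1+ a ]
1/[1+]-nonNeg a = *≤* (ℤ.+≤+ z≤n)

0≤1 : 0ℚ ≤ 1ℚ
0≤1 = fromℕ-mono-≤ {0} {1} z≤n

*-mono-≤-nonNeg : ∀ {a b c d} → 0ℚ ≤ a → 0ℚ ≤ c → a ≤ b → c ≤ d → a * c ≤ b * d
*-mono-≤-nonNeg {a} {b} {c} {d} 0≤a 0≤c a≤b c≤d =
  ≤-trans (*-monoʳ-≤-nonNeg c {{nonNegative 0≤c}} a≤b) (*-monoˡ-≤-nonNeg b {{nonNegative (≤-trans 0≤a a≤b)}} c≤d)

*-nonNeg : ∀ {a b} → 0ℚ ≤ a → 0ℚ ≤ b → 0ℚ ≤ a * b
*-nonNeg {a} {b} 0≤a 0≤b = subst (_≤ a * b) (*-zeroʳ a) (*-monoˡ-≤-nonNeg a {{nonNegative 0≤a}} 0≤b)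

^q-nonNeg : ∀ {a} k → 0ℚ ≤ a → 0ℚ ≤ a ^q k
^q-nonNeg zero    0≤a = 0≤1
^q-nonNeg (suc k) 0≤a = *-nonNeg 0≤a (^q-nonNeg k 0≤a)

^q-mono-≤ : ∀ {a b} k → 0ℚ ≤ a → a ≤ b → a ^q k ≤ b ^q k
^q-mono-≤ zero    0≤a a≤b = ≤-refl
^q-mono-≤ (suc k) 0≤a a≤b = *-mono-≤-nonNeg 0≤a (^q-nonNeg k 0≤a) a≤b (^q-mono-≤ k 0≤a a≤b)

∑-mono-≤ : ∀ n {f g : ℕ → ℚ} → (∀ i → i ℕ.< n → f i ≤ g i) → ∑ n f ≤ ∑ n g
∑-mono-≤ zero    f≤g = ≤-refl
∑-mono-≤ (suc n) f≤g = +-mono-≤ (∑-mono-≤ n (λ i i<n → f≤g i (ℕₚ.m<n⇒m<1+n i<n))) (f≤g n ℕₚ.≤-refl)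

∑-nonNeg : ∀ n {f : ℕ → ℚ} → (∀ i → i ℕ.< n → 0ℚ ≤ f i) → 0ℚ ≤ ∑ n f
∑-nonNeg n {f} 0≤f = subst (_≤ ∑ n f) (∑-zero n) (∑-mono-≤ n 0≤f)

∑-const : ∀ n c → ∑[ i < n ] c ≡ fromℕ n * c
∑-const zero    c = sym (*-zeroˡ c)
∑-const (suc n) c = begin
  ∑ n (λ _ → c) + c         ≡⟨ cong₂ _+_ (∑-const n c) (sym (*-identityˡ c)) ⟩
  fromℕ n * c + 1ℚ * c      ≡⟨ sym (*-distribʳ-+ c (fromℕ n) 1ℚ) ⟩
  (fromℕ n + 1ℚ) * c        ≡⟨ cong (_* c) (sym (fromℕ-suc n)) ⟩
  fromℕ (suc n) * c         ∎
  where open ≡-Reasoning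

∑-mono-≤-length : ∀ {a b} (f : ℕ → ℚ) → (∀ i → 0ℚ ≤ f i) → a ℕ.≤ b → ∑ a f ≤ ∑ b f
∑-mono-≤-length {a} {b} f 0≤f a≤b = subst₂ _≤_ (+-identityʳ (∑ a f))
  (trans (sym (∑-split a (b ∸ a) f)) (cong (λ k → ∑ k f) (ℕₚ.m+[n∸m]≡n a≤b)))
  (+-monoʳ-≤ (∑ a f) (∑-nonNeg (b ∸ a) (λ i _ → 0≤f (a ℕ.+ i))))

harmonic : ℕ → ℚ
harmonic n = ∑ n 1/[1+_]

harmonic-nonNeg : ∀ n → 0ℚ ≤ harmonic n
harmonic-nonNeg n = ∑-nonNeg n (λ i _ → 1/[1+]-nonNeg i)

harmonic-mono-≤ : ∀ {a b} → a ℕ.≤ b → harmonic a ≤ harmonic b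
harmonic-mono-≤ = ∑-mono-≤-length 1/[1+_] 1/[1+]-nonNeg

harmonic-double : ∀ p → harmonic (suc p ℕ.+ suc p) ≤ harmonic (suc p) + 1ℚ
harmonic-double p = begin
  harmonic (suc p ℕ.+ suc p)
    ≡⟨ ∑-split (suc p) (suc p) 1/[1+_] ⟩
  harmonic (suc p) + (∑[ i < suc p ] 1/[1+ suc p ℕ.+ i ])
    ≤⟨ +-monoʳ-≤ (harmonic (suc p))
         (∑-mono-≤ (suc p) (λ i _ → 1/[1+]-antimono-≤ (ℕₚ.≤-trans (ℕₚ.n≤1+n p) (ℕₚ.m≤m+n (suc p) i)))) ⟩
  harmonic (suc p) + (∑[ i < suc p ] 1/[1+ p ])
    ≡⟨ cong (harmonic (suc p) +_) (trans (∑-const (suc p) 1/[1+ p ]) (fromℕ*1/[1+]≡1 p)) ⟩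
  harmonic (suc p) + 1ℚ
    ∎
  where open ≤-Reasoning

harmonic-2^ : ∀ j → harmonic (2 ^ j) ≤ fromℕ (suc j)
harmonic-2^ zero    = ≤-reflexive (+-identityˡ 1/[1+ 0 ])
harmonic-2^ (suc j) with 2 ^ j | ℕₚ.m^n>0 2 j | harmonic-2^ j
... | suc p | _ | IH = begin
  harmonic (suc p ℕ.+ (suc p ℕ.+ 0))  ≡⟨ cong (λ k → harmonic (suc p ℕ.+ k)) (ℕₚ.+-identityʳ (suc p)) ⟩
  harmonic (suc p ℕ.+ suc p)          ≤⟨ harmonic-double p ⟩
  harmonic (suc p) + 1ℚ               ≤⟨ +-monoˡ-≤ 1ℚ IH ⟩
  fromℕ (suc j) + 1ℚ                  ≡⟨ sym (fromℕ-suc (suc j)) ⟩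
  fromℕ (suc (suc j))                 ∎
  where open ≤-Reasoning

dyadic-cover : ∀ n → ∃[ j ] (suc n ℕ.≤ 2 ^ j × 2 ^ j ℕ.≤ 2 ℕ.* suc n)
dyadic-cover zero = 0 , s≤s z≤n , s≤s z≤n
dyadic-cover (suc n) with dyadic-cover n
... | j , lower , upper with suc (suc n) ℕ.≤? 2 ^ j
...   | yes 2+n≤2^j = j , 2+n≤2^j , ℕₚ.≤-trans upper (ℕₚ.*-monoʳ-≤ 2 (ℕₚ.n≤1+n (suc n)))
...   | no  2+n≰2^j = suc j , lower′ , upper′
  where
  2^j≡1+n : 2 ^ j ≡ suc n
  2^j≡1+n = ℕₚ.≤-antisym (ℕₚ.≤-pred (ℕₚ.≰⇒> 2+n≰2^j)) lower
  lower′ : suc (suc n) ℕ.≤ 2 ^ suc j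
  lower′ rewrite 2^j≡1+n | ℕₚ.+-identityʳ n = s≤s (ℕₚ.m≤n+m (suc n) n)
  upper′ : 2 ^ suc j ℕ.≤ 2 ℕ.* suc (suc n)
  upper′ rewrite 2^j≡1+n = ℕₚ.*-monoʳ-≤ 2 (ℕₚ.n≤1+n (suc n))

1+n≤2^n : ∀ n → suc n ℕ.≤ 2 ^ n
1+n≤2^n zero    = s≤s z≤n
1+n≤2^n (suc n) = ℕₚ.+-mono-≤ (ℕₚ.m^n>0 2 n) (ℕₚ.≤-trans (1+n≤2^n n) (ℕₚ.m≤m+n (2 ^ n) 0))

^-distribʳ-* : ∀ a b k → (a ℕ.* b) ^ k ≡ a ^ k ℕ.* b ^ k
^-distribʳ-* a b zero    = refl
^-distribʳ-* a b (suc k) = trans (cong (a ℕ.* b ℕ.*_) (^-distribʳ-* a b k)) (interchange a b (a ^ k) (b ^ k))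
  where
  open import Algebra.Properties.CommutativeSemigroup ℕₚ.*-commutativeSemigroup using (interchange)

-- Write j = q(m+1) + r with r ≤ m; then j+1 ≤ (m+1) 2^q and q m ≤ j.
polynomial≤exponential : ∀ j m → suc j ^ m ℕ.≤ suc m ^ m ℕ.* 2 ^ j
polynomial≤exponential j m = begin
  suc j ^ m                    ≤⟨ ℕₚ.^-monoˡ-≤ m 1+j≤[1+m]2^q ⟩
  (suc m ℕ.* 2 ^ q) ^ m        ≡⟨ ^-distribʳ-* (suc m) (2 ^ q) m ⟩
  suc m ^ m ℕ.* (2 ^ q) ^ m    ≡⟨ cong (suc m ^ m ℕ.*_) (ℕₚ.^-*-assoc 2 q m) ⟩
  suc m ^ m ℕ.* 2 ^ (q ℕ.* m)  ≤⟨ ℕₚ.*-monoʳ-≤ (suc m ^ m) (ℕₚ.^-monoʳ-≤ 2 qm≤j) ⟩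
  suc m ^ m ℕ.* 2 ^ j          ∎
  where
  open ℕₚ.≤-Reasoning
  q = j ℕ./ suc m
  r = j % suc m
  j≡r+q[1+m] : j ≡ r ℕ.+ q ℕ.* suc m
  j≡r+q[1+m] = m≡m%n+[m/n]*n j (suc m)
  1+j≤[1+m]2^q : suc j ℕ.≤ suc m ℕ.* 2 ^ q
  1+j≤[1+m]2^q = ℕₚ.≤-trans (ℕₚ.≤-reflexive (cong suc j≡r+q[1+m]))
                 (ℕₚ.≤-trans (ℕₚ.+-monoˡ-≤ (q ℕ.* suc m) (m%n<n j (suc m)))
                 (ℕₚ.≤-trans (ℕₚ.≤-reflexive (ℕₚ.*-comm (suc q) (suc m))) (ℕₚ.*-monoʳ-≤ (suc m) (1+n≤2^n q))))
  qm≤j : q ℕ.* m ℕ.≤ j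
  qm≤j = ℕₚ.≤-trans (ℕₚ.*-monoʳ-≤ q (ℕₚ.n≤1+n m))
         (ℕₚ.≤-trans (ℕₚ.m≤n+m (q ℕ.* suc m) r) (ℕₚ.≤-reflexive (sym j≡r+q[1+m])))

harmonic^-constant : ℕ → ℕ
harmonic^-constant m = suc m ^ m ℕ.* 2

harmonic-^-linear : ∀ N m → harmonic (suc N) ^q m ≤ fromℕ (harmonic^-constant m ℕ.* suc N)
harmonic-^-linear N m with dyadic-cover N
... | j , 1+N≤2^j , 2^j≤2[1+N] = begin
  harmonic (suc N) ^q m
    ≤⟨ ^q-mono-≤ m (harmonic-nonNeg (suc N)) (≤-trans (harmonic-mono-≤ 1+N≤2^j) (harmonic-2^ j)) ⟩
  fromℕ (suc j) ^q m
    ≡⟨ fromℕ-^ (suc j) m ⟩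
  fromℕ (suc j ^ m)
    ≤⟨ fromℕ-mono-≤ (ℕₚ.≤-trans (polynomial≤exponential j m)
         (ℕₚ.≤-trans (ℕₚ.*-monoʳ-≤ (suc m ^ m) 2^j≤2[1+N])
                     (ℕₚ.≤-reflexive (sym (ℕₚ.*-assoc (suc m ^ m) 2 (suc N)))))) ⟩
  fromℕ (harmonic^-constant m ℕ.* suc N)
    ∎
  where open ≤-Reasoning

sameLimit-from-bound : ∀ (a b : ℕ → ℚ) c → (∀ N → ∣ a N - b N ∣ ≤ fromℕ c * 1/[1+ N ]) → SameLimit a b
sameLimit-from-bound a b c bound (mkℚ ℤ.+[1+ p ] q _) _ = c ℕ.* suc q , λ N cq≤N →
  ≤-trans (bound N) (≤-trans (c/[1+N]≤1/[1+q] N (ℕₚ.≤-trans cq≤N (ℕₚ.n≤1+n N))) 1/[1+q]≤ε)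
  where
  1/[1+q]≤ε : 1/[1+ q ] ≤ mkℚ ℤ.+[1+ p ] q _
  1/[1+q]≤ε = *≤* (subst₂ ℤ._≤_ (sym (ℤₚ.*-identityˡ (ℤ.+ suc q))) (ℤₚ.pos-* (suc p) (suc q))
                           (ℤ.+≤+ (ℕₚ.m≤n*m (suc q) (suc p))))
  c/[1+N]≤1/[1+q] : ∀ N → c ℕ.* suc q ℕ.≤ suc N → fromℕ c * 1/[1+ N ] ≤ 1/[1+ q ]
  c/[1+N]≤1/[1+q] N c[1+q]≤1+N = begin
    fromℕ c * 1/[1+ N ]
      ≡⟨ trans (sym (*-identityʳ _)) (cong (fromℕ c * 1/[1+ N ] *_) (sym (fromℕ*1/[1+]≡1 q))) ⟩
    (fromℕ c * 1/[1+ N ]) * (fromℕ (suc q) * 1/[1+ q ])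
      ≡⟨ regroup (fromℕ c) 1/[1+ N ] (fromℕ (suc q)) 1/[1+ q ] ⟩
    ((fromℕ c * fromℕ (suc q)) * 1/[1+ N ]) * 1/[1+ q ]
      ≡⟨ cong (λ z → (z * 1/[1+ N ]) * 1/[1+ q ]) (fromℕ-* c (suc q)) ⟩
    (fromℕ (c ℕ.* suc q) * 1/[1+ N ]) * 1/[1+ q ]
      ≤⟨ *-monoʳ-≤-nonNeg 1/[1+ q ] {{nonNegative (1/[1+]-nonNeg q)}}
           (*-monoʳ-≤-nonNeg 1/[1+ N ] {{nonNegative (1/[1+]-nonNeg N)}} (fromℕ-mono-≤ c[1+q]≤1+N)) ⟩
    (fromℕ (suc N) * 1/[1+ N ]) * 1/[1+ q ]
      ≡⟨ trans (cong (_* 1/[1+ q ]) (fromℕ*1/[1+]≡1 N)) (*-identityˡ _) ⟩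
    1/[1+ q ]
      ∎
    where
    open ≤-Reasoning
    regroup : ∀ a b c d → (a * b) * (c * d) ≡ ((a * c) * b) * d
    regroup = solve 4 (λ a b c d → (a :* b) :* (c :* d) := ((a :* c) :* b) :* d) refl
sameLimit-from-bound a b c bound (mkℚ (ℤ.+ zero) q _) (*<* (ℤ.+<+ ()))
sameLimit-from-bound a b c bound (mkℚ ℤ.-[1+ p ] q _) (*<* ())

SameLimit-cong : ∀ {a b c d : ℕ → ℚ} → (∀ N → a N ≡ c N) → (∀ N → b N ≡ d N) →
                 SameLimit c d → SameLimit a b
SameLimit-cong a≡c b≡d c~d ε 0<ε with c~d ε 0<ε
... | M , close = M , λ N M≤N → subst (λ z → ∣ z ∣ ≤ ε) (sym (cong₂ _-_ (a≡c N) (b≡d N))) (close N M≤N)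

module WeightBounds (x : ℕ → ℚ) (0≤x : ∀ a → 0ℚ ≤ x (suc a)) (x≤1/[1+] : ∀ a → x (suc a) ≤ 1/[1+ a ])
  where
  open SymmetricFunctions x

  x^1≤1/[1+] : ∀ a → x (suc a) ^q 1 ≤ 1/[1+ a ]
  x^1≤1/[1+] a = subst (_≤ 1/[1+ a ]) (sym (^q-identityʳ (x (suc a)))) (x≤1/[1+] a)

  e-nonNeg : ∀ n r → 0ℚ ≤ e n r
  e-nonNeg n zero    = 0≤1
  e-nonNeg n (suc r) = subst (0ℚ ≤_) (sym (Z-∷ n 1 (ones r)))
    (∑-nonNeg n (λ a _ → *-nonNeg (^q-nonNeg 1 (0≤x a)) (e-nonNeg a r)))

  e≤harmonic^ : ∀ n r → e n r ≤ harmonic n ^q r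
  e≤harmonic^ n zero    = ≤-refl
  e≤harmonic^ n (suc r) = begin
    e n (suc r)
      ≡⟨ Z-∷ n 1 (ones r) ⟩
    ∑[ a < n ] x (suc a) ^q 1 * e a r
      ≤⟨ ∑-mono-≤ n (λ a a<n → *-mono-≤-nonNeg (^q-nonNeg 1 (0≤x a)) (e-nonNeg a r) (x^1≤1/[1+] a)
           (≤-trans (e≤harmonic^ a r) (^q-mono-≤ r (harmonic-nonNeg a) (harmonic-mono-≤ (ℕₚ.<⇒≤ a<n))))) ⟩
    ∑[ a < n ] 1/[1+ a ] * harmonic n ^q r
      ≡⟨ sym (*-distribʳ-∑ n (harmonic n ^q r) 1/[1+_]) ⟩
    harmonic n ^q suc r
      ∎
    where open ≤-Reasoning

  h-nonNeg : ∀ n k → 0ℚ ≤ h n k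
  h-nonNeg n zero    = 0≤1
  h-nonNeg n (suc k) = subst (0ℚ ≤_) (sym (Z⋆-∷ n 1 (ones k)))
    (∑-nonNeg n (λ a _ → *-nonNeg (^q-nonNeg 1 (0≤x a)) (h-nonNeg (suc a) k)))

  h≤harmonic^ : ∀ n k → h n k ≤ harmonic n ^q k
  h≤harmonic^ n zero    = ≤-refl
  h≤harmonic^ n (suc k) = begin
    h n (suc k)
      ≡⟨ Z⋆-∷ n 1 (ones k) ⟩
    ∑[ a < n ] x (suc a) ^q 1 * h (suc a) k
      ≤⟨ ∑-mono-≤ n (λ a a<n → *-mono-≤-nonNeg (^q-nonNeg 1 (0≤x a)) (h-nonNeg (suc a) k) (x^1≤1/[1+] a)
           (≤-trans (h≤harmonic^ (suc a) k) (^q-mono-≤ k (harmonic-nonNeg (suc a)) (harmonic-mono-≤ a<n)))) ⟩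
    ∑[ a < n ] 1/[1+ a ] * harmonic n ^q k
      ≡⟨ sym (*-distribʳ-∑ n (harmonic n ^q k) 1/[1+_]) ⟩
    harmonic n ^q suc k
      ∎
    where open ≤-Reasoning

  eh⁺-nonNeg : ∀ n m → 0ℚ ≤ eh⁺ n m
  eh⁺-nonNeg n m = ∑-nonNeg (suc m) (λ k _ → *-nonNeg (e-nonNeg n (m ∸ k)) (h-nonNeg (suc n) k))

  eh⁺≤ : ∀ n m → eh⁺ n m ≤ fromℕ (suc m) * harmonic (suc n) ^q m
  eh⁺≤ n m = begin
    eh⁺ n m
      ≤⟨ ∑-mono-≤ (suc m) (λ k k≤m → *-mono-≤-nonNeg (e-nonNeg n (m ∸ k)) (h-nonNeg (suc n) k)
           (≤-trans (e≤harmonic^ n (m ∸ k)) (^q-mono-≤ (m ∸ k) (harmonic-nonNeg n) (harmonic-mono-≤ (ℕₚ.n≤1+n n))))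
           (h≤harmonic^ (suc n) k)) ⟩
    ∑[ k < suc m ] H ^q (m ∸ k) * H ^q k
      ≡⟨ ∑-cong-< (suc m) (λ k k<1+m → trans (sym (^q-distribˡ-+-* H (m ∸ k) k))
                                             (cong (H ^q_) (ℕₚ.m∸n+n≡m (ℕₚ.≤-pred k<1+m)))) ⟩
    ∑[ k < suc m ] H ^q m
      ≡⟨ ∑-const (suc m) (H ^q m) ⟩
    fromℕ (suc m) * H ^q m
      ∎
    where
    open ≤-Reasoning
    H = harmonic (suc n)

  x^l≤1/[1+]² : ∀ N l → 2 ℕ.≤ l → x (suc N) ^q l ≤ 1/[1+ N ] ^q 2
  x^l≤1/[1+]² N (suc (suc k)) (s≤s (s≤s z≤n)) = begin
    y ^q (2 ℕ.+ k)    ≡⟨ ^q-distribˡ-+-* y 2 k ⟩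
    y ^q 2 * y ^q k   ≤⟨ *-monoˡ-≤-nonNeg (y ^q 2) {{nonNegative (^q-nonNeg 2 (0≤x N))}} y^k≤1 ⟩
    y ^q 2 * 1ℚ       ≡⟨ *-identityʳ (y ^q 2) ⟩
    y ^q 2            ≤⟨ ^q-mono-≤ 2 (0≤x N) (x≤1/[1+] N) ⟩
    1/[1+ N ] ^q 2    ∎
    where
    open ≤-Reasoning
    y = x (suc N)
    1^q : ∀ k → 1ℚ ^q k ≡ 1ℚ
    1^q zero    = refl
    1^q (suc k) = trans (*-identityˡ (1ℚ ^q k)) (1^q k)
    y^k≤1 : y ^q k ≤ 1ℚ
    y^k≤1 = subst (y ^q k ≤_) (1^q k) (^q-mono-≤ k (0≤x N) (≤-trans (x≤1/[1+] N) (1/[1+]-antimono-≤ z≤n)))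

  lhsTerm-bound : ∀ η → (∀ n → ∣ η ^q n ∣ ≡ 1ℚ) → ∀ m l N → 2 ℕ.≤ l →
                  ∣ lhsTerm η m l N ∣ ≤ fromℕ (suc m ℕ.* harmonic^-constant m) * 1/[1+ N ]
  lhsTerm-bound η ∣η^n∣≡1 m l N 2≤l = begin
    ∣ η ^q N * y ^q l * eh⁺ N m ∣
      ≡⟨ trans (∣p*q∣≡∣p∣*∣q∣ (η ^q N * y ^q l) (eh⁺ N m))
               (cong₂ _*_ (∣p*q∣≡∣p∣*∣q∣ (η ^q N) (y ^q l)) (0≤p⇒∣p∣≡p (eh⁺-nonNeg N m))) ⟩
    ∣ η ^q N ∣ * ∣ y ^q l ∣ * eh⁺ N m
      ≡⟨ cong (_* eh⁺ N m)
              (trans (cong₂ _*_ (∣η^n∣≡1 N) (0≤p⇒∣p∣≡p (^q-nonNeg l (0≤x N)))) (*-identityˡ (y ^q l))) ⟩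
    y ^q l * eh⁺ N m
      ≤⟨ *-mono-≤-nonNeg (^q-nonNeg l (0≤x N)) (eh⁺-nonNeg N m) (x^l≤1/[1+]² N l 2≤l)
           (≤-trans (eh⁺≤ N m) (*-monoˡ-≤-nonNeg (fromℕ (suc m)) {{nonNegative (fromℕ-nonNeg (suc m))}}
                                                 (harmonic-^-linear N m))) ⟩
    r ^q 2 * (fromℕ (suc m) * fromℕ (harmonic^-constant m ℕ.* suc N))
      ≡⟨ cong (λ z → r ^q 2 * (fromℕ (suc m) * z)) (sym (fromℕ-* (harmonic^-constant m) (suc N))) ⟩
    r ^q 2 * (fromℕ (suc m) * (fromℕ (harmonic^-constant m) * fromℕ (suc N)))
      ≡⟨ regroup r (fromℕ (suc m)) (fromℕ (harmonic^-constant m)) (fromℕ (suc N)) ⟩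
    ((fromℕ (suc m) * fromℕ (harmonic^-constant m)) * r) * (fromℕ (suc N) * r)
      ≡⟨ cong₂ (λ u v → (u * r) * v) (fromℕ-* (suc m) (harmonic^-constant m)) (fromℕ*1/[1+]≡1 N) ⟩
    (fromℕ (suc m ℕ.* harmonic^-constant m) * r) * 1ℚ
      ≡⟨ *-identityʳ _ ⟩
    fromℕ (suc m ℕ.* harmonic^-constant m) * r
      ∎
    where
    open ≤-Reasoning
    y = x (suc N)
    r = 1/[1+ N ]
    regroup : ∀ r a k s → (r * (r * 1ℚ)) * (a * (k * s)) ≡ ((a * k) * r) * (s * r)
    regroup = solve 4 (λ r a k s → (r :* (r :* con 1ℚ)) :* (a :* (k :* s)) := ((a :* k) :* r) :* (s :* r)) refl

  sameLimit-partials : ∀ η → η * η ≡ 1ℚ → (∀ n → ∣ η ^q n ∣ ≡ 1ℚ) → ∀ m l → 2 ℕ.≤ l →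
                       SameLimit (lhsPartial η m l) (rhsPartial η m l)
  sameLimit-partials η η²≡1 ∣η^n∣≡1 m l 2≤l =
    sameLimit-from-bound (lhsPartial η m l) (rhsPartial η m l) c (λ N →
      subst (λ z → ∣ z ∣ ≤ fromℕ c * 1/[1+ N ]) (sym (partial-difference η m l N η²≡1))
            (lhsTerm-bound η ∣η^n∣≡1 m l N 2≤l))
    where
    c = suc m ℕ.* harmonic^-constant m

-- The weights 1/a and 1/(2a − 1)

module ζ = SymmetricFunctions recip
module t = SymmetricFunctions recipOdd

ζₙ≡Z : ∀ n s → ζₙ n s ≡ ζ.Z n s
ζₙ≡Z n []       = refl
ζₙ≡Z n (k ∷ ks) = sumFrom1-cong n (λ a → cong (recip a ^q k *_) (ζₙ≡Z (ℕ.pred a) ks))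

ζ⋆ₙ≡Z⋆ : ∀ n s → ζ⋆ₙ n s ≡ ζ.Z⋆ n s
ζ⋆ₙ≡Z⋆ n []       = refl
ζ⋆ₙ≡Z⋆ n (k ∷ ks) = sumFrom1-cong n (λ a → cong (recip a ^q k *_) (ζ⋆ₙ≡Z⋆ a ks))

tₙ≡Z : ∀ n s → tₙ n s ≡ t.Z n s
tₙ≡Z n []       = refl
tₙ≡Z n (k ∷ ks) = sumFrom1-cong n (λ a → cong (recipOdd a ^q k *_) (tₙ≡Z (ℕ.pred a) ks))

t⋆ₙ≡Z⋆ : ∀ n s → t⋆ₙ n s ≡ t.Z⋆ n s
t⋆ₙ≡Z⋆ n []       = refl
t⋆ₙ≡Z⋆ n (k ∷ ks) = sumFrom1-cong n (λ a → cong (recipOdd a ^q k *_) (t⋆ₙ≡Z⋆ a ks))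

ζηPartial≡ZPartial : ∀ η N s → ζηPartial η N s ≡ ζ.ZPartial η N s
ζηPartial≡ZPartial η N []        = refl
ζηPartial≡ZPartial η N (s₁ ∷ ss) =
  sumFrom1-cong N (λ a → cong ((η ^q a) * (recip a ^q s₁) *_) (ζₙ≡Z (ℕ.pred a) ss))

tηPartial≡ZPartial : ∀ η N s → tηPartial η N s ≡ t.ZPartial η N s
tηPartial≡ZPartial η N []        = refl
tηPartial≡ZPartial η N (s₁ ∷ ss) =
  sumFrom1-cong N (λ a → cong ((η ^q a) * (recipOdd a ^q s₁) *_) (tₙ≡Z (ℕ.pred a) ss))

lhsζ≡lhsPartial : ∀ η m l N → lhsζ η m l N ≡ ζ.lhsPartial η m l N
lhsζ≡lhsPartial η m l N = sumFrom0-cong m (λ k → sumFrom0-cong N (λ n →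
  cong₂ (λ u v → (η ^q n) * u * v * (recip (suc n) ^q l)) (ζₙ≡Z n (ones (m ∸ k))) (ζ⋆ₙ≡Z⋆ (suc n) (ones k))))

lhst≡lhsPartial : ∀ η m l N → lhst η m l N ≡ t.lhsPartial η m l N
lhst≡lhsPartial η m l N = sumFrom0-cong m (λ k → sumFrom0-cong N (λ n →
  cong₂ (λ u v → (η ^q n) * u * v * (recipOdd (suc n) ^q l)) (tₙ≡Z n (ones (m ∸ k))) (t⋆ₙ≡Z⋆ (suc n) (ones k))))

rhsζ≡rhsPartial : ∀ η m l N → rhsζ η m l N ≡ ζ.rhsPartial η m l N
rhsζ≡rhsPartial η m l N = cong (η *_) (sumFrom1-cong (suc m) (λ d → ΣComp-cong d (m ℕ.+ 2) (λ s →
  cong (two ^q ℕ.pred d *_) (ζηPartial≡ZPartial η N (shiftHead l s)))))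

rhst≡rhsPartial : ∀ η m l N → rhst η m l N ≡ t.rhsPartial η m l N
rhst≡rhsPartial η m l N = cong (η *_) (sumFrom1-cong (suc m) (λ d → ΣComp-cong d (m ℕ.+ 2) (λ s →
  cong (two ^q ℕ.pred d *_) (tηPartial≡ZPartial η N (shiftHead l s)))))

recip-weights : ∀ a → 0ℚ ≤ recip (suc a) × recip (suc a) ≤ 1/[1+ a ]
recip-weights a = subst (0ℚ ≤_) (sym (recip-suc a)) (1/[1+]-nonNeg a) , ≤-reflexive (recip-suc a)

recipOdd-weights : ∀ a → 0ℚ ≤ recipOdd (suc a) × recipOdd (suc a) ≤ 1/[1+ a ]
recipOdd-weights a = subst (0ℚ ≤_) (sym (recipOdd-suc a)) (1/[1+]-nonNeg (2 ℕ.* a))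
                   , subst (_≤ 1/[1+ a ]) (sym (recipOdd-suc a)) (1/[1+]-antimono-≤ (ℕₚ.m≤m+n a (a ℕ.+ 0)))

η²≡1 : ∀ {η} → η ≡ 1ℚ ⊎ η ≡ - 1ℚ → η * η ≡ 1ℚ
η²≡1 (inj₁ refl) = refl
η²≡1 (inj₂ refl) = refl

∣η^n∣≡1 : ∀ {η} → η ≡ 1ℚ ⊎ η ≡ - 1ℚ → ∀ n → ∣ η ^q n ∣ ≡ 1ℚ
∣η^n∣≡1 η≡±1 zero    = refl
∣η^n∣≡1 {η} η≡±1 (suc n) =
  trans (∣p*q∣≡∣p∣*∣q∣ η (η ^q n))
        (trans (cong₂ _*_ (∣η∣≡1 η≡±1) (∣η^n∣≡1 η≡±1 n)) (*-identityˡ 1ℚ))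
  where
  ∣η∣≡1 : ∀ {η} → η ≡ 1ℚ ⊎ η ≡ - 1ℚ → ∣ η ∣ ≡ 1ℚ
  ∣η∣≡1 (inj₁ refl) = refl
  ∣η∣≡1 (inj₂ refl) = refl

proposition6p1 : (η : ℚ) → (η ≡ 1ℚ ⊎ η ≡ - 1ℚ) → (m l : ℕ) → 2 ℕ.≤ l →
    SameLimit (lhsζ η m l) (rhsζ η m l) × SameLimit (lhst η m l) (rhst η m l)
proposition6p1 η η≡±1 m l 2≤l =
    SameLimit-cong (lhsζ≡lhsPartial η m l) (rhsζ≡rhsPartial η m l)
      (ζBounds.sameLimit-partials η (η²≡1 η≡±1) (∣η^n∣≡1 η≡±1) m l 2≤l)
  , SameLimit-cong (lhst≡lhsPartial η m l) (rhst≡rhsPartial η m l)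
      (tBounds.sameLimit-partials η (η²≡1 η≡±1) (∣η^n∣≡1 η≡±1) m l 2≤l)
  where
  module ζBounds = WeightBounds recip (proj₁ ∘ recip-weights) (proj₂ ∘ recip-weights)
  module tBounds = WeightBounds recipOdd (proj₁ ∘ recipOdd-weights) (proj₂ ∘ recipOdd-weights)
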